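{- For every integer $k\geq 9$, we have $\mathrm{URT}(k)\leq \mathrm{RT}(\lfloor k/3\rfloor)$.
   Context: For a word $x=x_1\cdots x_n$ (letters $x_i$), its reversal is $x^R=x_n\cdots x_1$. For rational $1<r\leq 2$, an (ordinary) $r$-power is a word $xyx$ with $x$ nonempty and $|xyx|/|xy|=r$; an undirected $r$-power is a word $xyx'$ with $x$ nonempty, $x'\in\{x,x^R\}$, and $|xyx'|/|xy|=r$. For real $1<\alpha\leq 2$, a word is (undirected) $\alpha$-free if none of its factors is an (undirected, respectively) $r$-power for any rational $r\geq\alpha$, and $\alpha^+$-free if none of its factors is such an $r$-power with $r>\alpha$. Undirected $r$-powers are $k$-avoidable if there is an infinite word over a $k$-letter alphabet that is undirected $r$-free. The undirected repetition threshold is $\mathrm{URT}(k)=\inf\{r : \text{undirected } r\text{ -powers are } k\text{ -avoidable}\}$, and the (ordinary) repetition threshold $\mathrm{RT}(k)$ is defined analogously using ordinary $r$-powers ($\mathrm{RT}(k)=\inf\{r: \text{there is an infinite } k\text{ -ary word that is } r\text{ -free}\}$). -}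

module Defs where

open import Data.Nat using (ℕ; suc; _+_; _∸_; _<_; _≤_)
open import Data.Fin using (Fin)
open import Data.Integer using (+_)
open import Data.Rational as ℚ using (ℚ; _/_)
open import Data.Product using (∃)
open import Data.Sum using (_⊎_)
open import Relation.Binary.PropositionalEquality using (_≡_)
open import Relation.Nullary using (¬_)

ℕ→ℚ : ℕ → ℚ
ℕ→ℚ n = (+ n) / 1

Word : ℕ → Set
Word k = ℕ → Fin k

-- The factor of w starting at position i of length d + e is an (ordinary)
-- r-power x y x with |x| = e ≥ 1, |x y| = d, e ≤ d (so r = (d+e)/d ∈ (1,2]).
OrdPowerAt : ∀ {k} → Word k → (i d e : ℕ) → Set
OrdPowerAt w i d e = ∀ j → j < e → w (i + j) ≡ w (i + d + j)

-- The factor of w starting at i of length d + e is x y x^R with |x| = e, |xy| = d.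
RevPowerAt : ∀ {k} → Word k → (i d e : ℕ) → Set
RevPowerAt w i d e = ∀ j → j < e → w (i + d + j) ≡ w (i + (e ∸ 1 ∸ j))

UndPowerAt : ∀ {k} → Word k → (i d e : ℕ) → Set
UndPowerAt w i d e = OrdPowerAt w i d e ⊎ RevPowerAt w i d e

-- exponent (d+e)/d is ≥ α  (written α · d ≤ d + e), with 1 ≤ e ≤ d
Admissible : ℚ → (d e : ℕ) → Set
Admissible α d e = (1 ≤ e) Data.Product.× (e ≤ d) Data.Product.× (α ℚ.* ℕ→ℚ d ℚ.≤ ℕ→ℚ (d + e))

Free : ∀ {k} → ℚ → Word k → Set
Free α w = ∀ i d e → Admissible α d e → ¬ OrdPowerAt w i d e

UFree : ∀ {k} → ℚ → Word k → Set
UFree α w = ∀ i d e → Admissible α d e → ¬ UndPowerAt w i d e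

Avoidable : ℕ → ℚ → Set
Avoidable k α = ∃ λ (w : Word k) → Free α w

UAvoidable : ℕ → ℚ → Set
UAvoidable k α = ∃ λ (w : Word k) → UFree α w

-- Take an r-free word w over ⌊k/3⌋ letters and tag the letter at position n with n mod 3,
-- giving a word over 3⌊k/3⌋ ≤ k letters. Ordinary repetitions in the tagged word project to
-- repetitions of w with the same exponent. A reversed factor x y x^R with |x| ≥ 2 cannot occur:
-- reading x forwards the tags increase by 1 mod 3, reading x^R they decrease, and comparing the
-- first two letters forces 2 ≡ 0 (mod 3); with |x| = 1 reversal is an ordinary repetition.
module Submission where

open import Defs
open import Data.Nat using (ℕ; _≤_; _/_)
open import Data.Rational as ℚ using (ℚ)

open import Data.Nat using (zero; suc; _+_; _*_; _%_; _<_; s≤s; z≤n)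
open import Data.Nat.Properties using (+-identityʳ; +-suc; +-comm)
open import Data.Nat.DivMod using (_mod_; m%n<n; %-distribˡ-+; m/n*n≤m)
open import Data.Fin using (Fin; toℕ; inject≤; combine)
open import Data.Fin.Properties using (toℕ-fromℕ<; inject≤-injective; combine-injective)
import Data.Rational.Properties as ℚP
open import Data.Product using (_,_; _×_; proj₁; proj₂)
open import Data.Sum using (inj₁; inj₂)
open import Function using (_∘_)
open import Function.Definitions using (Injective)
open import Relation.Binary.PropositionalEquality
open import Relation.Nullary using (¬_)

Admissible-antitone : ∀ {r s} → r ℚ.≤ s → ∀ {d e} → Admissible s d e → Admissible r d e
Admissible-antitone r≤s {d} (1≤e , e≤d , sd≤d+e) =
  1≤e , e≤d , ℚP.≤-trans (ℚP.*-monoʳ-≤-nonNeg (ℕ→ℚ d) {{ℚP.normalize-nonNeg d 1}} r≤s) sd≤d+e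

Free-mono : ∀ {k r s} {w : Word k} → r ℚ.≤ s → Free r w → Free s w
Free-mono r≤s free i d e adm = free i d e (Admissible-antitone r≤s adm)

UFree-map : ∀ {m n α} {f : Fin m → Fin n} {w : Word m} →
            Injective _≡_ _≡_ f → UFree α w → UFree α (f ∘ w)
UFree-map f-inj free i d e adm (inj₁ ord) = free i d e adm (inj₁ (λ j j<e → f-inj (ord j j<e)))
UFree-map f-inj free i d e adm (inj₂ rev) = free i d e adm (inj₂ (λ j j<e → f-inj (rev j j<e)))

UAvoidable-mono : ∀ {m n α} → m ≤ n → UAvoidable m α → UAvoidable n α
UAvoidable-mono {α = α} m≤n (w , free) =
  inject≤-word , UFree-map {α = α} {w = w} (inject≤-injective m≤n m≤n _ _) free
  where
  inject≤-word : Word _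
  inject≤-word i = inject≤ (w i) m≤n

RevPowerAt-1⇒OrdPowerAt : ∀ {k} {w : Word k} {i d} → RevPowerAt w i d 1 → OrdPowerAt w i d 1
RevPowerAt-1⇒OrdPowerAt rev zero _ = sym (rev zero (s≤s z≤n))
RevPowerAt-1⇒OrdPowerAt rev (suc _) (s≤s ())

%3-suc-not-swapped : ∀ a b → a % 3 ≡ suc b % 3 → ¬ (suc a % 3 ≡ b % 3)
%3-suc-not-swapped a b a≡b+1 a+1≡b =
  residue-cycle (b % 3) (m%n<n b 3) (begin
    suc (suc (b % 3) % 3) % 3 ≡⟨ cong (λ x → suc x % 3) (trans (sym (suc-% b)) (sym a≡b+1)) ⟩
    suc (a % 3) % 3           ≡⟨ sym (suc-% a) ⟩
    suc a % 3                 ≡⟨ a+1≡b ⟩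
    b % 3                     ∎)
  where
  open ≡-Reasoning
  suc-% : ∀ n → suc n % 3 ≡ suc (n % 3) % 3
  suc-% n = %-distribˡ-+ 1 n 3
  residue-cycle : ∀ y → y < 3 → ¬ (suc (suc y % 3) % 3 ≡ y)
  residue-cycle 0 _ ()
  residue-cycle 1 _ ()
  residue-cycle 2 _ ()
  residue-cycle (suc (suc (suc _))) (s≤s (s≤s (s≤s ())))

module _ {m : ℕ} (w : Word m) where

  tag : Word (m * 3)
  tag n = combine (w n) (n mod 3)

  tag-injective : ∀ {x y} → tag x ≡ tag y → w x ≡ w y × x mod 3 ≡ y mod 3
  tag-injective {x} {y} = combine-injective (w x) (x mod 3) (w y) (y mod 3)

  tag-letter : ∀ {x y} → tag x ≡ tag y → w x ≡ w y
  tag-letter = proj₁ ∘ tag-injective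

  tag-residue : ∀ {x y} → tag x ≡ tag y → x % 3 ≡ y % 3
  tag-residue {x} {y} eq = begin
    x % 3         ≡⟨ toℕ-fromℕ< (m%n<n x 3) ⟨
    toℕ (x mod 3) ≡⟨ cong toℕ (proj₂ (tag-injective eq)) ⟩
    toℕ (y mod 3) ≡⟨ toℕ-fromℕ< (m%n<n y 3) ⟩
    y % 3         ∎
    where open ≡-Reasoning

  tag-no-long-RevPowerAt : ∀ i d e → ¬ RevPowerAt tag i d (suc (suc e))
  tag-no-long-RevPowerAt i d e rev =
    %3-suc-not-swapped (i + d) (i + e)
      (trans (cong (_% 3) (sym (+-identityʳ (i + d))))
        (trans (tag-residue (rev 0 (s≤s z≤n))) (cong (_% 3) (+-suc i e))))
      (trans (cong (_% 3) (+-comm 1 (i + d))) (tag-residue (rev 1 (s≤s (s≤s z≤n)))))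

  tag-UFree : ∀ {α} → Free α w → UFree α tag
  tag-UFree free i d e adm (inj₁ ord) = free i d e adm (λ j j<e → tag-letter (ord j j<e))
  tag-UFree free i d zero (() , _) (inj₂ _)
  tag-UFree free i d 1 adm (inj₂ rev) =
    free i d 1 adm (RevPowerAt-1⇒OrdPowerAt {w = w} {i} {d} (λ j j<1 → tag-letter (rev j j<1)))
  tag-UFree free i d (suc (suc e)) adm (inj₂ rev) = tag-no-long-RevPowerAt i d e rev

theorem1 : (k : ℕ) → 9 ≤ k →
    (r s : ℚ) → ℚ.1ℚ ℚ.< r → r ℚ.< s → s ℚ.≤ ℕ→ℚ 2 →
    Avoidable (k / 3) r → UAvoidable k s
theorem1 k _ r s _ r<s _ (w , free) =
  UAvoidable-mono {α = s} (m/n*n≤m k 3) (tag w , tag-UFree w {s} (Free-mono {w = w} (ℚP.<⇒≤ r<s) free))
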